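{- Let $p$ be an odd prime and $n \ge 2p+1$ an integer with $n \equiv 1 \pmod{2p}$, and let $a$ be a positive integer such that $a^p + 1 \equiv 0 \pmod n$ and $\gcd(a^i \pm 1, n) = 1$ for $1 \le i \le p-1$. Then the circulant $\mathrm{Cay}(\mathbb{Z}_n, \langle [a]\rangle)$ is isomorphic to $G_p(A_{p,n,-a})$, where $$A_{p,n,-a} = \left\{\sum_{i=0}^{p-2} a_i\zeta_p^i \in \mathbb{Z}[\zeta_p] : a_i \in \mathbb{Z},\ \sum_{i=0}^{p-2} a_i(-a)^i \equiv 0 \pmod n\right\}.$$
   Context: $\zeta_p = e^{2\pi i/p}$ and $\mathbb{Z}[\zeta_p]$ is the ring of integers of $\mathbb{Q}(\zeta_p)$, with $\mathbb{Z}$-basis $1, \zeta_p, \dots, \zeta_p^{p-2}$. $\langle [a]\rangle$ is the cyclic subgroup of $\mathbb{Z}_n^*$ generated by the residue class of $a$, and $\mathrm{Cay}(\mathbb{Z}_n, S)$ is the Cayley graph on the additive group $\mathbb{Z}_n$ with $x,y$ adjacent iff $x-y\in S$. For a nonzero ideal $A$ of $\mathbb{Z}[\zeta_p]$, $G_p(A)$ is the Cayley graph on the additive group of $\mathbb{Z}[\zeta_p]/A$ with connection set $\{\pm(\zeta_p^i + A) : 0 \le i \le p-1\}$. -}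

module Defs where

open import Data.Nat as ℕ using (ℕ; zero; suc; pred; _<_)
open import Data.Integer as ℤ using (ℤ; +_; _-_; _*_; -_)
open import Data.Integer.Divisibility using (_∣_)
open import Data.Fin using (Fin; zero; suc; toℕ; fromℕ; inject₁)
open import Data.Product using (Σ; ∃; _×_)
open import Data.Sum using (_⊎_)
open import Relation.Binary.PropositionalEquality using (_≡_)
open import Function.Bundles using (_⇔_)

-- Z[ζ_p] represented in the Z-basis 1, ζ, …, ζ^(p-2): coordinate vectors of length p-1.
ZZeta : ℕ → Set
ZZeta p = Fin (pred p) → ℤ

_⊕_ _⊖_ : ∀ {k} → (Fin k → ℤ) → (Fin k → ℤ) → (Fin k → ℤ)
(x ⊕ y) i = x i ℤ.+ y i
(x ⊖ y) i = x i - y i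

oneZ : ∀ p → ZZeta p
oneZ zero ()
oneZ (suc zero) ()
oneZ (suc (suc m)) zero = + 1
oneZ (suc (suc m)) (suc _) = + 0

-- multiplication by ζ_p, using ζ^(p-1) = -(1 + ζ + … + ζ^(p-2))
mulζ : ∀ p → ZZeta p → ZZeta p
mulζ zero c = c
mulζ (suc zero) c = c
mulζ (suc (suc m)) c zero = - c (fromℕ m)
mulζ (suc (suc m)) c (suc j) = c (inject₁ j) - c (fromℕ m)

ζ^ : ∀ p → ℕ → ZZeta p
ζ^ p zero = oneZ p
ζ^ p (suc i) = mulζ p (ζ^ p i)

sumFin : ∀ {k} → (Fin k → ℤ) → ℤ
sumFin {zero} f = + 0
sumFin {suc k} f = f zero ℤ.+ sumFin (λ i → f (suc i))

A : (p n : ℕ) → ℤ → ZZeta p → Set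
A p n b c = (+ n) ∣ sumFin (λ i → c i * (b ℤ.^ toℕ i))

-- G_p(A): Cayley graph on Z[ζ_p]/A with connection set {±(ζ^i + A) : 0 ≤ i ≤ p-1}.
-- Vertices are representatives in Z[ζ_p]; two represent the same vertex iff their difference lies in A.
sameVertexG : ∀ p → (ZZeta p → Set) → ZZeta p → ZZeta p → Set
sameVertexG p S x y = S (x ⊖ y)

adjG : ∀ p → (ZZeta p → Set) → ZZeta p → ZZeta p → Set
adjG p S x y = ∃ λ i → i < p × (S ((x ⊖ y) ⊖ ζ^ p i) ⊎ S ((x ⊖ y) ⊕ ζ^ p i))

adjCirc : (n a : ℕ) → Fin n → Fin n → Set
adjCirc n a x y = ∃ λ k → (+ n) ∣ ((+ toℕ x - + toℕ y) - (+ a) ℤ.^ k)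

CircIsoGp : (n a p : ℕ) → (ZZeta p → Set) → Set
CircIsoGp n a p S =
  Σ (Fin n → ZZeta p) λ f →
    (∀ x y → sameVertexG p S (f x) (f y) → x ≡ y) ×
    (∀ z → ∃ λ x → sameVertexG p S (f x) z) ×
    (∀ x y → adjCirc n a x y ⇔ adjG p S (f x) (f y))

module Submission where

-- Write b = -a.  Evaluating a coordinate vector at ζ = b,
--   ev (Σᵢ cᵢ ζⁱ) = Σᵢ cᵢ bⁱ,
-- is ℤ-linear, and by definition A_{p,n,b} = { c : ev c ≡ 0 (mod n) }.  Reducing
-- ζ^(p-1) = -(1 + ⋯ + ζ^(p-2)) changes ev by a multiple of 1 + b + ⋯ + b^(p-1),
-- which n divides because n ∣ bᵖ - 1 = (b - 1)(1 + ⋯ + b^(p-1)) and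
-- gcd(n, b - 1) = gcd(n, a + 1) = 1; hence ev ζⁱ ≡ bⁱ (mod n).  So the map
-- x ↦ x·1 from ℤₙ to ℤ[ζ]/A is a bijection (ev inverts it), and x·1 - y·1 ∓ ζⁱ
-- lies in A iff x - y ≡ ±bⁱ.  Finally x - y ≡ aᵏ for some k iff x - y ≡ ±bⁱ for
-- some i < p: aᵏ = ±bᵏ, the powers of b have period p as bᵖ ≡ 1, and
-- -aᵏ ≡ a^(k+p) as aᵖ ≡ -1.
-- The file first develops evaluation and geometric sums, congruences modulo N
-- (also up to sign), residues modulo n, and powers modulo N; then the images of
-- the ζⁱ and the isomorphism; the theorem only translates its hypotheses.

open import Defs
open import Data.Nat.Base as ℕ using (ℕ; zero; suc; NonZero; z≤n; s≤s)
import Data.Nat.Properties as ℕP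
import Data.Nat.Divisibility as ℕD
open import Data.Nat.GCD using (gcd)
open import Data.Nat.Coprimality as Coprime using (Coprime; gcd≡1⇒coprime)
open import Data.Integer.Base using (ℤ; +_; -_; ∣_∣; 0ℤ; 1ℤ)
import Data.Integer.Base as Integer
import Data.Integer.Properties as ℤP
import Data.Integer.Divisibility.Signed as Signed
import Data.Integer.Coprimality as ℤ
open import Data.Integer.DivMod using (_/ℕ_; _%ℕ_; n%ℕd<d; a≡a%ℕn+[a/ℕn]*n)
open import Data.Integer.Tactic.RingSolver using (solve-∀)
open import Algebra.Properties.Semiring.Sum ℤP.+-*-semiring
  using (sum; sum-cong-≗; ∑-distrib-+; *-distribˡ-sum; sum-init-last)
open import Data.Fin.Base using (Fin; zero; suc; toℕ; fromℕ; fromℕ<; inject₁)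
open import Data.Fin.Properties using (toℕ-inject₁; toℕ-fromℕ; toℕ-fromℕ<; toℕ-injective; toℕ<n)
open import Data.Product.Base using (_×_; _,_; proj₁; proj₂; ∃)
open import Data.Sum.Base as Sum using (_⊎_; inj₁; inj₂)
open import Data.Sum.Function.Propositional using (_⊎-⇔_)
open import Function.Bundles using (_⇔_; mk⇔; Equivalence)
open import Function.Construct.Composition using (_⇔-∘_)
open import Function.Construct.Symmetry using (⇔-sym)
open import Level using (0ℓ)
open import Relation.Nullary using (¬_; contradiction)
open import Relation.Binary.Bundles using (Setoid)
open import Relation.Binary.PropositionalEquality
  using (_≡_; refl; sym; trans; cong; cong₂; subst; subst₂; module ≡-Reasoning)

sumFin≡sum : ∀ {k} (f : Fin k → ℤ) → sumFin f ≡ sum f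
sumFin≡sum {zero}  f = refl
sumFin≡sum {suc k} f = cong (Integer._+_ (f zero)) (sumFin≡sum (λ i → f (suc i)))

sumFin-cong : ∀ {k} {f g : Fin k → ℤ} → (∀ i → f i ≡ g i) → sumFin f ≡ sumFin g
sumFin-cong {f = f} {g} f≗g =
  trans (sumFin≡sum f) (trans (sum-cong-≗ f≗g) (sym (sumFin≡sum g)))

module Evaluation (b : ℤ) where
  open Integer using (_+_; _-_; _*_; _^_)
  open ≡-Reasoning

  ev : ∀ {k} → (Fin k → ℤ) → ℤ
  ev c = sumFin (λ i → c i * b ^ toℕ i)

  geometric : ℕ → ℤ
  geometric k = ev {k} (λ _ → 1ℤ)

  ev-as-sum : ∀ {k} (c : Fin k → ℤ) → ev c ≡ sum (λ i → c i * b ^ toℕ i)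
  ev-as-sum c = sumFin≡sum (λ i → c i * b ^ toℕ i)

  ev-cong : ∀ {k} {c d : Fin k → ℤ} → (∀ i → c i ≡ d i) → ev c ≡ ev d
  ev-cong c≗d = sumFin-cong (λ i → cong (_* b ^ toℕ i) (c≗d i))

  ev-⊕ : ∀ {k} (c d : Fin k → ℤ) → ev (c ⊕ d) ≡ ev c + ev d
  ev-⊕ c d = begin
    ev (c ⊕ d)                       ≡⟨ ev-as-sum (c ⊕ d) ⟩
    sum (λ i → (c i + d i) * w i)     ≡⟨ sum-cong-≗ (λ i → ℤP.*-distribʳ-+ (w i) (c i) (d i)) ⟩
    sum (λ i → c i * w i + d i * w i) ≡⟨ ∑-distrib-+ (λ i → c i * w i) (λ i → d i * w i) ⟩
    sum (λ i → c i * w i) + sum (λ i → d i * w i)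
      ≡⟨ cong₂ _+_ (ev-as-sum c) (ev-as-sum d) ⟨
    ev c + ev d                      ∎
    where w = λ i → b ^ toℕ i

  ev-scale : ∀ {k} t (c : Fin k → ℤ) → ev (λ i → t * c i) ≡ t * ev c
  ev-scale t c = begin
    ev (λ i → t * c i)              ≡⟨ ev-as-sum (λ i → t * c i) ⟩
    sum (λ i → (t * c i) * w i)     ≡⟨ sum-cong-≗ (λ i → ℤP.*-assoc t (c i) (w i)) ⟩
    sum (λ i → t * (c i * w i))     ≡⟨ *-distribˡ-sum t (λ i → c i * w i) ⟨
    t * sum (λ i → c i * w i)       ≡⟨ cong (t *_) (ev-as-sum c) ⟨
    t * ev c                        ∎
    where w = λ i → b ^ toℕ i

  ev-⊖ : ∀ {k} (c d : Fin k → ℤ) → ev (c ⊖ d) ≡ ev c - ev d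
  ev-⊖ c d = begin
    ev (c ⊖ d)                ≡⟨ add-sub (ev (c ⊖ d)) (ev d) ⟩
    ev (c ⊖ d) + ev d - ev d  ≡⟨ cong (_- ev d) (ev-⊕ (c ⊖ d) d) ⟨
    ev ((c ⊖ d) ⊕ d) - ev d   ≡⟨ cong (_- ev d) (ev-cong (λ i → sub-add (c i) (d i))) ⟩
    ev c - ev d               ∎
    where
      add-sub : ∀ u v → u ≡ u + v - v
      add-sub = solve-∀
      sub-add : ∀ u v → u - v + v ≡ u
      sub-add = solve-∀

  ev-const : ∀ {k} t → ev {k} (λ _ → t) ≡ t * geometric k
  ev-const {k} t = trans (ev-cong {k} (λ _ → sym (ℤP.*-identityʳ t))) (ev-scale {k} t (λ _ → 1ℤ))

  ev-head : ∀ {k} (c : Fin (suc k) → ℤ) → ev c ≡ c zero + b * ev (λ j → c (suc j))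
  ev-head c = cong₂ _+_ (ℤP.*-identityʳ (c zero))
    (trans (sumFin-cong (λ j → shift (c (suc j)) b (b ^ toℕ j))) (ev-scale b (λ j → c (suc j))))
    where
      shift : ∀ x y w → x * (y * w) ≡ y * x * w
      shift = solve-∀

  ev-init-last : ∀ {k} (c : Fin (suc k) → ℤ) →
    ev c ≡ ev (λ j → c (inject₁ j)) + c (fromℕ k) * b ^ k
  ev-init-last {k} c = begin
    ev c                                    ≡⟨ ev-as-sum c ⟩
    sum (λ i → c i * b ^ toℕ i)             ≡⟨ sum-init-last (λ i → c i * b ^ toℕ i) ⟩
    sum (λ j → c (inject₁ j) * b ^ toℕ (inject₁ j)) + c (fromℕ k) * b ^ toℕ (fromℕ k)
      ≡⟨ cong₂ _+_ (trans (sum-cong-≗ λ j → cong (λ e → c (inject₁ j) * b ^ e) (toℕ-inject₁ j))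
                          (sym (ev-as-sum (λ j → c (inject₁ j)))))
                   (cong (λ e → c (fromℕ k) * b ^ e) (toℕ-fromℕ k)) ⟩
    ev (λ j → c (inject₁ j)) + c (fromℕ k) * b ^ k ∎

  geometric-head : ∀ k → geometric (suc k) ≡ 1ℤ + b * geometric k
  geometric-head k = ev-head {k} (λ _ → 1ℤ)

  geometric-last : ∀ k → geometric (suc k) ≡ geometric k + b ^ k
  geometric-last k = trans (ev-init-last {k} (λ _ → 1ℤ)) (cong (_+_ (geometric k)) (ℤP.*-identityˡ (b ^ k)))

  geometric-sum : ∀ k → (b - 1ℤ) * geometric k ≡ b ^ k - 1ℤ
  geometric-sum zero    = ℤP.*-zeroʳ (b - 1ℤ)
  geometric-sum (suc k) = begin
    (b - 1ℤ) * geometric (suc k)              ≡⟨ cong ((b - 1ℤ) *_) (geometric-last k) ⟩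
    (b - 1ℤ) * (geometric k + b ^ k)          ≡⟨ ℤP.*-distribˡ-+ (b - 1ℤ) (geometric k) (b ^ k) ⟩
    (b - 1ℤ) * geometric k + (b - 1ℤ) * b ^ k ≡⟨ cong (_+ (b - 1ℤ) * b ^ k) (geometric-sum k) ⟩
    b ^ k - 1ℤ + (b - 1ℤ) * b ^ k             ≡⟨ telescope b (b ^ k) ⟩
    b * b ^ k - 1ℤ                            ∎
    where
      telescope : ∀ x y → y - 1ℤ + (x - 1ℤ) * y ≡ x * y - 1ℤ
      telescope = solve-∀

  ev-one : ∀ m → ev (oneZ (suc (suc m))) ≡ 1ℤ
  ev-one m = begin
    ev (oneZ (suc (suc m)))     ≡⟨ ev-head (oneZ (suc (suc m))) ⟩
    1ℤ + b * ev {m} (λ _ → 0ℤ)  ≡⟨ cong (λ t → 1ℤ + b * t) (ev-const {m} 0ℤ) ⟩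
    1ℤ + b * (0ℤ * geometric m) ≡⟨ cong (λ t → 1ℤ + b * t) (ℤP.*-zeroˡ (geometric m)) ⟩
    1ℤ + b * 0ℤ                 ≡⟨ cong (_+_ 1ℤ) (ℤP.*-zeroʳ b) ⟩
    1ℤ                          ∎

  -- Multiplication by ζ: the top coefficient T wraps around as -T(1 + ζ + ⋯ + ζ^(p-2)).
  ev-mulζ : ∀ m (c : Fin (suc m) → ℤ) →
    ev (mulζ (suc (suc m)) c) ≡ b * ev c - c (fromℕ m) * geometric (suc (suc m))
  ev-mulζ m c = begin
    ev (mulζ (suc (suc m)) c)                   ≡⟨ ev-head (mulζ (suc (suc m)) c) ⟩
    - T + b * ev (low ⊖ (λ _ → T))              ≡⟨ cong (λ t → - T + b * t) (ev-⊖ low (λ _ → T)) ⟩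
    - T + b * (ev low - ev {m} (λ _ → T))       ≡⟨ cong (λ t → - T + b * (ev low - t)) (ev-const {m} T) ⟩
    - T + b * (ev low - T * geometric m)        ≡⟨ rearrange T b (ev low) (geometric m) (b ^ m) ⟩
    b * (ev low + T * b ^ m) - T * (1ℤ + b * (geometric m + b ^ m))
      ≡⟨ cong₂ (λ u v → b * u - T * v) (ev-init-last c)
               (trans (geometric-head (suc m)) (cong (λ g → 1ℤ + b * g) (geometric-last m))) ⟨
    b * ev c - T * geometric (suc (suc m))      ∎
    where
      T = c (fromℕ m)
      low = λ j → c (inject₁ j)
      rearrange : ∀ t x s g y → - t + x * (s - t * g) ≡ x * (s + t * y) - t * (1ℤ + x * (g + y))
      rearrange = solve-∀

module Congruence (N : ℤ) where
  open Integer using (_-_; _*_)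
  open Signed using (_∣_; divides; ∣m∣n⇒∣m+n; ∣m⇒∣-m; ∣n⇒∣m*n)

  infix 4 _≈_ _≈±_

  -- x ≈ y means N ∣ x - y (a record, so that x and y can be inferred)
  record _≈_ (x y : ℤ) : Set where
    constructor mod
    field divisible : N ∣ x - y
  open _≈_ public

  ≈-by : ∀ {u x y} → N ∣ u → u ≡ x - y → x ≈ y
  ≈-by N∣u refl = mod N∣u

  ≈-reflexive : ∀ {x y} → x ≡ y → x ≈ y
  ≈-reflexive {x} refl = ≈-by (divides 0ℤ (sym (ℤP.*-zeroˡ N))) (sym (ℤP.+-inverseʳ x))

  ≈-refl : ∀ {x} → x ≈ x
  ≈-refl = ≈-reflexive refl

  ≈-sym : ∀ {x y} → x ≈ y → y ≈ x
  ≈-sym {x} {y} x≈y = ≈-by (∣m⇒∣-m (divisible x≈y)) (flip x y)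
    where
      flip : ∀ u v → - (u - v) ≡ v - u
      flip = solve-∀

  ≈-trans : ∀ {x y z} → x ≈ y → y ≈ z → x ≈ z
  ≈-trans {x} {y} {z} x≈y y≈z =
    ≈-by (∣m∣n⇒∣m+n (divisible x≈y) (divisible y≈z)) (ℤP.+-minus-telescope x y z)

  ≈-setoid : Setoid 0ℓ 0ℓ
  ≈-setoid = record
    { Carrier = ℤ
    ; _≈_ = _≈_
    ; isEquivalence = record { refl = ≈-refl ; sym = ≈-sym ; trans = ≈-trans }
    }

  neg-cong : ∀ {x y} → x ≈ y → - x ≈ - y
  neg-cong {x} {y} x≈y = ≈-by (∣m⇒∣-m (divisible x≈y)) (regroup x y)
    where
      regroup : ∀ x y → - (x - y) ≡ - x - - y
      regroup = solve-∀

  *-congˡ : ∀ c {x y} → x ≈ y → c * x ≈ c * y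
  *-congˡ c {x} {y} x≈y = ≈-by (∣n⇒∣m*n c (divisible x≈y)) (distrib c x y)
    where
      distrib : ∀ c x y → c * (x - y) ≡ c * x - c * y
      distrib = solve-∀

  minus-multiple : ∀ {u} x → N ∣ u → x - u ≈ x
  minus-multiple {u} x N∣u = ≈-by (∣m⇒∣-m N∣u) (regroup x u)
    where
      regroup : ∀ x u → - u ≡ (x - u) - x
      regroup = solve-∀

  _≈±_ : ℤ → ℤ → Set
  x ≈± y = x ≈ y ⊎ x ≈ - y

  ≈±-reflexive : ∀ {x y} → x ≡ y ⊎ x ≡ - y → x ≈± y
  ≈±-reflexive = Sum.map ≈-reflexive ≈-reflexive

  ≈±-trans : ∀ {x y z} → x ≈± y → y ≈± z → x ≈± z
  ≈±-trans (inj₁ x≈y)  (inj₁ y≈z)  = inj₁ (≈-trans x≈y y≈z)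
  ≈±-trans (inj₁ x≈y)  (inj₂ y≈-z) = inj₂ (≈-trans x≈y y≈-z)
  ≈±-trans (inj₂ x≈-y) (inj₁ y≈z)  = inj₂ (≈-trans x≈-y (neg-cong y≈z))
  ≈±-trans {z = z} (inj₂ x≈-y) (inj₂ y≈-z) =
    inj₁ (≈-trans x≈-y (≈-trans (neg-cong y≈-z) (≈-reflexive (ℤP.neg-involutive z))))

  ≈±-sym : ∀ {x y} → x ≈± y → y ≈± x
  ≈±-sym (inj₁ x≈y) = inj₁ (≈-sym x≈y)
  ≈±-sym {y = y} (inj₂ x≈-y) =
    inj₂ (≈-trans (≈-reflexive (sym (ℤP.neg-involutive y))) (neg-cong (≈-sym x≈-y)))

  ∣⇔≈ : ∀ {x y} → N ∣ x - y ⇔ x ≈ y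
  ∣⇔≈ = mk⇔ mod divisible

multiple-below⇒zero : ∀ {d m} → d ℕD.∣ m → m ℕ.< d → m ≡ 0
multiple-below⇒zero {m = zero}  _   _   = refl
multiple-below⇒zero {m = suc m} d∣m m<d = contradiction d∣m (ℕD.>⇒∤ m<d)

module Residues (n : ℕ) where
  open Integer using (_+_; _-_; _*_)
  open Congruence (+ n)

  -- |x - y| < n, so n ∣ x - y forces x = y
  residue-injective : ∀ {x y} → x ℕ.< n → y ℕ.< n → + x ≈ + y → x ≡ y
  residue-injective {x} {y} x<n y<n (mod n∣x-y) =
    ℤP.+-injective (ℤP.i-j≡0⇒i≡j (+ x) (+ y)
      (ℤP.∣i∣≡0⇒i≡0 (multiple-below⇒zero (Signed.∣⇒∣ᵤ n∣x-y) distance<n)))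
    where
      distance<n : ∣ + x - + y ∣ ℕ.< n
      distance<n = subst (ℕ._< n) (cong ∣_∣ (sym (ℤP.[+m]-[+n]≡m⊖n x y)))
        (ℕP.≤-<-trans (ℤP.∣m⊝n∣≤m⊔n x y) (ℕP.⊔-pres-<m x<n y<n))

  remainder≈ : .{{_ : NonZero n}} → ∀ e → + (e %ℕ n) ≈ e
  remainder≈ e = ≈-by (Signed.divides (- q) refl) (begin
    - q * + n            ≡⟨ cancel r q (+ n) ⟩
    r - (r + q * + n)    ≡⟨ cong (_-_ r) (a≡a%ℕn+[a/ℕn]*n e n) ⟨
    r - e                ∎)
    where
      open ≡-Reasoning
      r = + (e %ℕ n)
      q = e /ℕ n
      cancel : ∀ r q N → - q * N ≡ r - (r + q * N)
      cancel = solve-∀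

module _ where
  open Integer using (_*_; _^_)

  pos-^ : ∀ a k → (+ a) ^ k ≡ + (a ℕ.^ k)
  pos-^ a zero    = refl
  pos-^ a (suc k) = trans (cong (+ a *_) (pos-^ a k)) (sym (ℤP.pos-* a (a ℕ.^ k)))

  neg-^-parity : ∀ x k → (2 ℕD.∣ k × (- x) ^ k ≡ x ^ k) ⊎ (2 ℕD.∣ suc k × (- x) ^ k ≡ - (x ^ k))
  neg-^-parity x zero = inj₁ (2 ℕD.∣0 , refl)
  neg-^-parity x (suc k) with neg-^-parity x k
  ... | inj₁ (2∣k , even) = inj₂ (ℕD.∣m∣n⇒∣m+n ℕD.∣-refl 2∣k ,
          trans (cong (- x *_) even) (sym (ℤP.neg-distribˡ-* x (x ^ k))))
  ... | inj₂ (2∣k+1 , odd) = inj₁ (2∣k+1 , trans (cong (- x *_) odd) (negate-both x (x ^ k)))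
    where
      negate-both : ∀ x y → - x * - y ≡ x * y
      negate-both = solve-∀

  neg-^-sign : ∀ x k → (- x) ^ k ≡ x ^ k ⊎ (- x) ^ k ≡ - (x ^ k)
  neg-^-sign x k = Sum.map proj₂ proj₂ (neg-^-parity x k)

  neg-^-odd : ∀ x {k} → ¬ 2 ℕD.∣ k → (- x) ^ k ≡ - (x ^ k)
  neg-^-odd x {k} k-odd with neg-^-parity x k
  ... | inj₁ (2∣k , _) = contradiction 2∣k k-odd
  ... | inj₂ (_ , odd) = odd

module Powers (N : ℤ) where
  open Integer using (_*_; _^_)
  open Congruence N
  open import Relation.Binary.Reasoning.Setoid ≈-setoid

  periodic : ∀ {p} x → 0 ℕ.< p → x ^ p ≈ 1ℤ → ∀ k → ∃ λ r → r ℕ.< p × x ^ k ≈ x ^ r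
  periodic x 0<p xᵖ≈1 zero = 0 , 0<p , ≈-refl
  periodic x 0<p xᵖ≈1 (suc k) with periodic x 0<p xᵖ≈1 k
  ... | r , r<p , xᵏ≈xʳ with ℕP.m≤n⇒m<n∨m≡n r<p
  ...   | inj₁ r+1<p = suc r , r+1<p , *-congˡ x xᵏ≈xʳ
  ...   | inj₂ refl  = 0 , 0<p , ≈-trans (*-congˡ x xᵏ≈xʳ) xᵖ≈1

  negated-power : ∀ {p} x → x ^ p ≈ - 1ℤ → ∀ k → - (x ^ k) ≈ x ^ (k ℕ.+ p)
  negated-power {p} x xᵖ≈-1 k = begin
    - (x ^ k)        ≡⟨ times-minus-one (x ^ k) ⟩
    x ^ k * - 1ℤ     ≈⟨ *-congˡ (x ^ k) xᵖ≈-1 ⟨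
    x ^ k * x ^ p    ≡⟨ ℤP.^-distribˡ-+-* x k p ⟨
    x ^ (k ℕ.+ p)    ∎
    where
      times-minus-one : ∀ y → - y ≡ y * - 1ℤ
      times-minus-one = solve-∀

  odd-power-of-negation : ∀ {p} x → ¬ 2 ℕD.∣ p → x ^ p ≈ - 1ℤ → (- x) ^ p ≈ 1ℤ
  odd-power-of-negation x p-odd xᵖ≈-1 = ≈-trans (≈-reflexive (neg-^-odd x p-odd)) (neg-cong xᵖ≈-1)

  powers-of-negation : ∀ {p} α → 0 ℕ.< p → α ^ p ≈ - 1ℤ → (- α) ^ p ≈ 1ℤ →
    ∀ D → (∃ λ k → D ≈ α ^ k) ⇔ (∃ λ i → i ℕ.< p × D ≈± (- α) ^ i)
  powers-of-negation {p} α 0<p αᵖ≈-1 bᵖ≈1 D = mk⇔ to from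
    where
      to : (∃ λ k → D ≈ α ^ k) → ∃ λ i → i ℕ.< p × D ≈± (- α) ^ i
      to (k , D≈αᵏ) with periodic (- α) 0<p bᵖ≈1 k
      ... | r , r<p , bᵏ≈bʳ = r , r<p ,
        ≈±-trans (inj₁ D≈αᵏ) (≈±-trans (≈±-sym (≈±-reflexive (neg-^-sign α k))) (inj₁ bᵏ≈bʳ))

      from : (∃ λ i → i ℕ.< p × D ≈± (- α) ^ i) → ∃ λ k → D ≈ α ^ k
      from (i , _ , D≈±bⁱ) with ≈±-trans D≈±bⁱ (≈±-reflexive (neg-^-sign α i))
      ... | inj₁ D≈αⁱ  = i , D≈αⁱ
      ... | inj₂ D≈-αⁱ = i ℕ.+ p , ≈-trans D≈-αⁱ (negated-power α αᵖ≈-1 i)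

module ZetaPowers (m : ℕ) (b N : ℤ) where
  open Integer using (_-_; _*_; _^_)
  open Evaluation b
  open Congruence N

  p : ℕ
  p = suc (suc m)

  -- N divides 1 + b + ⋯ + b^(k-1), since it divides (b - 1)(1 + ⋯ + b^(k-1)) = bᵏ - 1.
  geometric-divisible : ∀ k → ℤ.Coprime N (b - 1ℤ) → b ^ k ≈ 1ℤ → N Signed.∣ geometric k
  geometric-divisible k coprime (mod N∣bᵏ-1) = Signed.∣ᵤ⇒∣
    (ℤ.coprime-divisor N (b - 1ℤ) (geometric k) coprime
      (Signed.∣⇒∣ᵤ (subst (N Signed.∣_) (sym (geometric-sum k)) N∣bᵏ-1)))

  module _ (coprime : ℤ.Coprime N (b - 1ℤ)) (bᵖ≈1 : b ^ p ≈ 1ℤ) where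

    ev-mulζ≈ : ∀ c → ev (mulζ p c) ≈ b * ev c
    ev-mulζ≈ c = subst (_≈ b * ev c) (sym (ev-mulζ m c))
      (minus-multiple (b * ev c) (Signed.∣n⇒∣m*n (c (fromℕ m)) (geometric-divisible p coprime bᵖ≈1)))

    ev-ζ^ : ∀ i → ev (ζ^ p i) ≈ b ^ i
    ev-ζ^ zero    = ≈-reflexive (ev-one m)
    ev-ζ^ (suc i) = ≈-trans (ev-mulζ≈ (ζ^ p i)) (*-congˡ b (ev-ζ^ i))

module Isomorphism (m n a : ℕ) where
  open Integer using (_+_; _-_; _*_; _^_)

  p : ℕ
  p = suc (suc m)

  N α b : ℤ
  N = + n
  α = + a
  b = - α

  open Evaluation b
  open Congruence N
  open Residues n
  open Powers N
  open ZetaPowers m b N using (ev-ζ^)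

  ∈A⇔ : ∀ c {e} → ev c ≡ e → A p n b c ⇔ N Signed.∣ e
  ∈A⇔ c refl = mk⇔ Signed.∣ᵤ⇒∣ Signed.∣⇒∣ᵤ

  ∈A-⊖ : ∀ v w → A p n b (v ⊖ w) ⇔ ev v ≈ ev w
  ∈A-⊖ v w = ∣⇔≈ ⇔-∘ ∈A⇔ (v ⊖ w) (ev-⊖ v w)

  ∈A-⊕ : ∀ v w → A p n b (v ⊕ w) ⇔ ev v ≈ - ev w
  ∈A-⊕ v w = ∣⇔≈ ⇔-∘ ∈A⇔ (v ⊕ w)
    (trans (ev-⊕ v w) (cong (_+_ (ev v)) (sym (ℤP.neg-involutive (ev w)))))

  embed : Fin n → ZZeta p
  embed x i = + toℕ x * oneZ p i

  ev-embed : ∀ x → ev (embed x) ≡ + toℕ x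
  ev-embed x = trans (ev-scale (+ toℕ x) (oneZ p))
    (trans (cong (+ toℕ x *_) (ev-one m)) (ℤP.*-identityʳ (+ toℕ x)))

  embed-injective : ∀ x y → sameVertexG p (A p n b) (embed x) (embed y) → x ≡ y
  embed-injective x y x~y = toℕ-injective (residue-injective (toℕ<n x) (toℕ<n y)
    (subst₂ _≈_ (ev-embed x) (ev-embed y) (Equivalence.to (∈A-⊖ (embed x) (embed y)) x~y)))

  -- every z is equivalent to the embedding of the remainder of ev z
  embed-surjective : .{{_ : NonZero n}} → ∀ z → ∃ λ x → sameVertexG p (A p n b) (embed x) z
  embed-surjective z = x , Equivalence.from (∈A-⊖ (embed x) z)
    (subst (_≈ ev z) (sym (trans (ev-embed x) (cong +_ (toℕ-fromℕ< remainder<n)))) (remainder≈ (ev z)))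
    where
      remainder<n = n%ℕd<d (ev z) n
      x = fromℕ< remainder<n

  module _ (αᵖ≈-1 : α ^ p ≈ - 1ℤ) (bᵖ≈1 : b ^ p ≈ 1ℤ) (coprime : ℤ.Coprime N (b - 1ℤ)) where

    adjG⇔ : ∀ v w → adjG p (A p n b) v w ⇔ (∃ λ i → i ℕ.< p × ev (v ⊖ w) ≈± b ^ i)
    adjG⇔ v w = mk⇔ to from
      where
        ∈A-± : ∀ i → (A p n b ((v ⊖ w) ⊖ ζ^ p i) ⊎ A p n b ((v ⊖ w) ⊕ ζ^ p i))
                     ⇔ ev (v ⊖ w) ≈± ev (ζ^ p i)
        ∈A-± i = ∈A-⊖ (v ⊖ w) (ζ^ p i) ⊎-⇔ ∈A-⊕ (v ⊖ w) (ζ^ p i)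

        to : adjG p (A p n b) v w → ∃ λ i → i ℕ.< p × ev (v ⊖ w) ≈± b ^ i
        to (i , i<p , adj) =
          i , i<p , ≈±-trans (Equivalence.to (∈A-± i) adj) (inj₁ (ev-ζ^ coprime bᵖ≈1 i))

        from : (∃ λ i → i ℕ.< p × ev (v ⊖ w) ≈± b ^ i) → adjG p (A p n b) v w
        from (i , i<p , d≈±bⁱ) =
          i , i<p , Equivalence.from (∈A-± i)
                      (≈±-trans d≈±bⁱ (inj₁ (≈-sym (ev-ζ^ coprime bᵖ≈1 i))))

    adjCirc⇔ : ∀ x y → adjCirc n a x y ⇔ (∃ λ k → ev (embed x ⊖ embed y) ≈ α ^ k)
    adjCirc⇔ x y = mk⇔
      (λ (k , h) → k , mod (subst (λ d → N Signed.∣ d - α ^ k) (sym difference) (Signed.∣ᵤ⇒∣ h)))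
      (λ (k , mod h) → k , Signed.∣⇒∣ᵤ (subst (λ d → N Signed.∣ d - α ^ k) difference h))
      where
        difference : ev (embed x ⊖ embed y) ≡ + toℕ x - + toℕ y
        difference = trans (ev-⊖ (embed x) (embed y)) (cong₂ _-_ (ev-embed x) (ev-embed y))

    -- both adjacencies reduce to: ev (x·1 - y·1) ≡ ± bⁱ for some i < p
    adjacency : ∀ x y → adjCirc n a x y ⇔ adjG p (A p n b) (embed x) (embed y)
    adjacency x y = ⇔-sym (adjG⇔ (embed x) (embed y))
      ⇔-∘ (powers-of-negation α (s≤s z≤n) αᵖ≈-1 bᵖ≈1 _ ⇔-∘ adjCirc⇔ x y)

    isomorphism : .{{_ : NonZero n}} → CircIsoGp n a p (A p n b)
    isomorphism = embed , embed-injective , embed-surjective , adjacency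

module Hypotheses (n a : ℕ) where
  open Integer using (_+_; _-_; _^_)
  open Congruence (+ n)
  open Powers (+ n) using (odd-power-of-negation)

  a^p≈-1 : ∀ p → n ℕD.∣ a ℕ.^ p ℕ.+ 1 → (+ a) ^ p ≈ - 1ℤ
  a^p≈-1 p n∣aᵖ+1 =
    mod (subst (+ n Signed.∣_) shape (Signed.∣ᵤ⇒∣ {+ n} {+ (a ℕ.^ p ℕ.+ 1)} n∣aᵖ+1))
    where
      shape : + (a ℕ.^ p ℕ.+ 1) ≡ (+ a) ^ p - - 1ℤ
      shape = trans (ℤP.pos-+ (a ℕ.^ p) 1) (cong (_+ 1ℤ) (sym (pos-^ a p)))

  [-a]^p≈1 : ∀ p → ¬ 2 ℕD.∣ p → n ℕD.∣ a ℕ.^ p ℕ.+ 1 → (- + a) ^ p ≈ 1ℤ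
  [-a]^p≈1 p p-odd n∣aᵖ+1 = odd-power-of-negation (+ a) p-odd (a^p≈-1 p n∣aᵖ+1)

  -- gcd(n, -a - 1) = gcd(n, a + 1)
  coprime-to-[-a]-1 : gcd (a ℕ.^ 1 ℕ.+ 1) n ≡ 1 → ℤ.Coprime (+ n) (- + a - 1ℤ)
  coprime-to-[-a]-1 gcd≡1 = subst (Coprime n) (sym ∣-a-1∣≡a+1)
    (subst (λ t → Coprime n (t ℕ.+ 1)) (ℕP.*-identityʳ a) (Coprime.sym (gcd≡1⇒coprime gcd≡1)))
    where
      negate-sum : ∀ x → - x - 1ℤ ≡ - (x + 1ℤ)
      negate-sum = solve-∀
      ∣-a-1∣≡a+1 : ∣ - + a - 1ℤ ∣ ≡ a ℕ.+ 1
      ∣-a-1∣≡a+1 = trans (cong ∣_∣ (trans (negate-sum (+ a)) (cong -_ (sym (ℤP.pos-+ a 1)))))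
                         (ℤP.∣-i∣≡∣i∣ (+ (a ℕ.+ 1)))

open import Data.Nat using (_+_; _*_; _∸_; _^_; _≤_; _<_)
open import Data.Nat.Primality using (Prime; ¬prime[0]; ¬prime[1])
open import Data.Nat.Divisibility using (_∣_)

theorem5p5 : (p n a : ℕ) → Prime p → ¬ (2 ∣ p) →
    2 * p + 1 ≤ n → (2 * p) ∣ (n ∸ 1) →
    1 ≤ a → n ∣ (a ^ p + 1) →
    (∀ i → 1 ≤ i → i ≤ p ∸ 1 → gcd (a ^ i + 1) n ≡ 1 × gcd (a ^ i ∸ 1) n ≡ 1) →
    CircIsoGp n a p (A p n (- (+ a)))
theorem5p5 zero          _ _ p-prime _ _ _ _ _ _ = contradiction p-prime ¬prime[0]
theorem5p5 (suc zero)    _ _ p-prime _ _ _ _ _ _ = contradiction p-prime ¬prime[1]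
theorem5p5 (suc (suc m)) zero _ _ _ () _ _ _ _
theorem5p5 p@(suc (suc m)) n@(suc _) a _ p-odd _ _ _ n∣aᵖ+1 gcd-condition =
  Isomorphism.isomorphism m n a (a^p≈-1 p n∣aᵖ+1) ([-a]^p≈1 p p-odd n∣aᵖ+1)
    (coprime-to-[-a]-1 gcd[a+1,n]≡1)
  where
    open Hypotheses n a
    gcd[a+1,n]≡1 : gcd (a ^ 1 + 1) n ≡ 1
    gcd[a+1,n]≡1 = proj₁ (gcd-condition 1 (s≤s z≤n) (s≤s z≤n))
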